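{- For every integer $n \ge 1$, the graph $G_n$ (defined in the context) has a frozen $(3n+1)$-colouring.
   Context: All graphs are finite and simple. A $k$-colouring of $G$ is a map $\alpha: V(G)\to\{1,\dots,k\}$ with $\alpha(u)\ne\alpha(v)$ for every edge $uv$. A $k$-colouring is frozen if for every vertex $v$, all $k$ colours appear on the closed neighbourhood of $v$ (equivalently, it is an isolated vertex of the graph of $k$-colourings in which two colourings are adjacent when they differ on exactly one vertex). Let $G_1$ be the graph with 8 vertices $w,x,y,z,a_w,a_x,a_y,a_z$ and 16 edges: $wx, xz, zy, yw$ (so $wz, xy$ are non-edges), and for each $v \in \{w,x,y,z\}$ the edges $v a_u$ for every $u \in \{w,x,y,z\}\setminus\{v\}$; there are no other edges (in particular $a_w,a_x,a_y,a_z$ are pairwise non-adjacent and $v a_v$ is a non-edge). For $n \ge 2$, $G_n$ is obtained from $G_1$ by substituting a separate (vertex-disjoint) copy of $G_{n-1}$ for each of the four vertices $a_w,a_x,a_y,a_z$, where substituting $H$ for a vertex $a$ of $G$ means taking the disjoint union of $G-a$ and $H$ and joining every vertex of $H$ to every neighbour of $a$ in $G$. -}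

module Defs where

open import Data.Nat using (ℕ; zero; suc)
open import Data.Fin using (Fin)
open import Data.Sum using (_⊎_; inj₁; inj₂)
open import Data.Product using (_×_; ∃; Σ; _,_)
open import Data.Empty using (⊥)
open import Data.Unit using (⊤)
open import Relation.Binary.PropositionalEquality using (_≡_; _≢_)

record Graph : Set₁ where
  field
    V   : Set
    Adj : V → V → Set
open Graph public

IsColouring : (G : Graph) (k : ℕ) → (V G → Fin k) → Set
IsColouring G k α = ∀ u v → Adj G u v → α u ≢ α v

IsFrozen : (G : Graph) (k : ℕ) → (V G → Fin k) → Set
IsFrozen G k α = ∀ (v : V G) (c : Fin k) → (α v ≡ c) ⊎ ∃ λ u → Adj G v u × (α u ≡ c)

HasFrozenColouring : Graph → ℕ → Set
HasFrozenColouring G k = Σ (V G → Fin k) λ α → IsColouring G k α × IsFrozen G k α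

data Core : Set where
  w x y z : Core

CoreAdj : Core → Core → Set
CoreAdj w x = ⊤
CoreAdj x w = ⊤
CoreAdj x z = ⊤
CoreAdj z x = ⊤
CoreAdj z y = ⊤
CoreAdj y z = ⊤
CoreAdj y w = ⊤
CoreAdj w y = ⊤
CoreAdj _ _ = ⊥

-- Vertices of G₁: inj₁ v is the core vertex v, inj₂ u is a_u.
G1V : Set
G1V = Core ⊎ Core

G1Adj : G1V → G1V → Set
G1Adj (inj₁ v) (inj₁ u) = CoreAdj v u
G1Adj (inj₁ v) (inj₂ u) = v ≢ u
G1Adj (inj₂ u) (inj₁ v) = v ≢ u
G1Adj (inj₂ _) (inj₂ _) = ⊥

G1 : Graph
G1 = record { V = G1V ; Adj = G1Adj }

-- Substituting a separate copy of H for each of a_w, a_x, a_y, a_z in G₁.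
-- Vertex inj₁ v : core vertex v of G₁;  inj₂ (u , h) : vertex h of the copy of H replacing a_u.
SubstAll : Graph → Graph
SubstAll H = record { V = Core ⊎ (Core × V H) ; Adj = A }
  where
  A : Core ⊎ (Core × V H) → Core ⊎ (Core × V H) → Set
  A (inj₁ v) (inj₁ v') = G1Adj (inj₁ v) (inj₁ v')
  A (inj₁ v) (inj₂ (u , _)) = G1Adj (inj₁ v) (inj₂ u)
  A (inj₂ (u , _)) (inj₁ v) = G1Adj (inj₂ u) (inj₁ v)
  A (inj₂ (u , h)) (inj₂ (u' , h')) = (u ≡ u') × Adj H h h'

-- G n for n ≥ 1: G 1 = G₁, G (n+1) = SubstAll (G n).
-- (G 0 is never used; it is set to the empty graph.)
G : ℕ → Graph
G zero = record { V = ⊥ ; Adj = λ _ _ → ⊥ }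
G (suc zero) = G1
G (suc (suc n)) = SubstAll (G (suc n))

{-# OPTIONS --safe #-}
module Submission where

-- Frozen colourings lift through the substitution: if H has a frozen colouring with
-- colours 0, …, m and a vertex, give the core vertices w, x, y, z four new colours
-- c_w, …, c_z and, in the copy of H replacing a_u, recolour colour 0 by c_u.  This
-- colours SubstAll H with 3 + (m + 1) colours.  It is proper because the copy replacing
-- a_u is joined exactly to the core vertices other than u.  It is frozen because a core
-- vertex v sees c_t (t ≠ v) in the copy replacing a_t and colours 1, …, m in any copy
-- replacing a_u with u ≠ v (a frozen colouring of a nonempty graph uses every colour),
-- while a copy vertex sees all of its copy's colours by frozenness of H and every c_t,
-- t ≠ u, on the core.  G₁ is the same construction applied to a single vertex.

open import Defs
open import Data.Nat using (ℕ; suc; _≤_; _*_; _+_; s≤s)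
open import Data.Nat.Properties using (*-suc; +-assoc)
open import Data.Fin using (Fin; zero; suc; _↑ˡ_; _↑ʳ_)
open import Data.Fin.Properties using (↑ˡ-injective; ↑ʳ-injective)
import Data.Fin.Properties as Fin
open import Data.Sum using (_⊎_; inj₁; inj₂)
open import Data.Product using (_×_; ∃; _,_)
open import Data.Empty using (⊥; ⊥-elim)
open import Data.Unit using (⊤; tt)
open import Function using (_∘_)
open import Relation.Nullary using (Dec; yes; no; ¬_)
open import Relation.Nullary.Decidable using (map′)
open import Relation.Binary.PropositionalEquality
  using (_≡_; _≢_; refl; sym; trans; cong; subst)

Sees : (G : Graph) {k : ℕ} → (V G → Fin k) → V G → Fin k → Set
Sees G α v c = (α v ≡ c) ⊎ ∃ λ u → Adj G v u × (α u ≡ c)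

frozen⇒surjective : ∀ {H k} {β : V H → Fin k} →
                    IsFrozen H k β → V H → ∀ c → ∃ λ h → β h ≡ c
frozen⇒surjective frozen p c with frozen p c
... | inj₁ βp≡c           = p , βp≡c
... | inj₂ (h , _ , βh≡c) = h , βh≡c

record LocallySurjectiveHom (G′ G : Graph) : Set where
  field
    vmap      : V G′ → V G
    preserves : ∀ {a b} → Adj G′ a b → Adj G (vmap a) (vmap b)
    lift      : ∀ {a b} → Adj G (vmap a) b → ∃ λ b′ → Adj G′ a b′ × vmap b′ ≡ b

hasFrozenColouring-pullback : ∀ {G′ G k} → LocallySurjectiveHom G′ G →
                              HasFrozenColouring G k → HasFrozenColouring G′ k
hasFrozenColouring-pullback {G′} {G} {k} f (α , proper , frozen) =
  α ∘ vmap , proper′ , frozen′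
  where
  open LocallySurjectiveHom f

  proper′ : IsColouring G′ k (α ∘ vmap)
  proper′ a b adj = proper (vmap a) (vmap b) (preserves adj)

  frozen′ : IsFrozen G′ k (α ∘ vmap)
  frozen′ v c with frozen (vmap v) c
  ... | inj₁ αv≡c           = inj₁ αv≡c
  ... | inj₂ (u , adj , αu≡c) with lift adj
  ...   | u′ , adj′ , refl    = inj₂ (u′ , adj′ , αu≡c)

index : Core → Fin 4
index w = zero
index x = suc zero
index y = suc (suc zero)
index z = suc (suc (suc zero))

index⁻¹ : Fin 4 → Core
index⁻¹ zero                   = w
index⁻¹ (suc zero)             = x
index⁻¹ (suc (suc zero))       = y
index⁻¹ (suc (suc (suc zero))) = z

index⁻¹-index : ∀ a → index⁻¹ (index a) ≡ a
index⁻¹-index w = refl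
index⁻¹-index x = refl
index⁻¹-index y = refl
index⁻¹-index z = refl

index-injective : ∀ {a b} → index a ≡ index b → a ≡ b
index-injective {a} {b} e =
  trans (sym (index⁻¹-index a)) (trans (cong index⁻¹ e) (index⁻¹-index b))

_≟_ : (a b : Core) → Dec (a ≡ b)
a ≟ b = map′ index-injective (cong index) (index a Fin.≟ index b)

CoreAdj-irrefl : ∀ a → ¬ CoreAdj a a
CoreAdj-irrefl w ()
CoreAdj-irrefl x ()
CoreAdj-irrefl y ()
CoreAdj-irrefl z ()

CoreAdj⇒≢ : ∀ {a b} → CoreAdj a b → a ≢ b
CoreAdj⇒≢ {a} adj refl = CoreAdj-irrefl a adj

another : Core → Core
another w = x
another x = w
another y = w
another z = w

another-≢ : ∀ v → v ≢ another v
another-≢ w ()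
another-≢ x ()
another-≢ y ()
another-≢ z ()

module SubstAllColouring {H : Graph} {k : ℕ} (β : V H → Fin (suc k)) where

  coreColour : Core → Fin (4 + k)
  coreColour t = index t ↑ˡ k

  copyColour : Core → Fin (suc k) → Fin (4 + k)
  copyColour u zero    = coreColour u
  copyColour u (suc j) = 4 ↑ʳ j

  α : V (SubstAll H) → Fin (4 + k)
  α (inj₁ v)       = coreColour v
  α (inj₂ (u , h)) = copyColour u (β h)

  data Palette : Fin (4 + k) → Set where
    core  : ∀ t → Palette (coreColour t)
    extra : ∀ j → Palette (4 ↑ʳ j)

  palette : ∀ c → Palette c
  palette zero                      = core w
  palette (suc zero)                = core x
  palette (suc (suc zero))          = core y
  palette (suc (suc (suc zero)))    = core z
  palette (suc (suc (suc (suc j)))) = extra j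

  coreColour-injective : ∀ {a b} → coreColour a ≡ coreColour b → a ≡ b
  coreColour-injective e = index-injective (↑ˡ-injective k _ _ e)

  coreColour≢extra : ∀ t j → coreColour t ≢ 4 ↑ʳ j
  coreColour≢extra w j ()
  coreColour≢extra x j ()
  coreColour≢extra y j ()
  coreColour≢extra z j ()

  copyColour-injective : ∀ u {i j} → copyColour u i ≡ copyColour u j → i ≡ j
  copyColour-injective u {zero}  {zero}  _ = refl
  copyColour-injective u {zero}  {suc j} e = ⊥-elim (coreColour≢extra u j e)
  copyColour-injective u {suc i} {zero}  e = ⊥-elim (coreColour≢extra u i (sym e))
  copyColour-injective u {suc i} {suc j} e = cong suc (↑ʳ-injective 4 i j e)

  copyColour≢coreColour : ∀ {u v} c → v ≢ u → copyColour u c ≢ coreColour v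
  copyColour≢coreColour zero    v≢u e = v≢u (sym (coreColour-injective e))
  copyColour≢coreColour {v = v} (suc j) _ e = coreColour≢extra v j (sym e)

  α-proper : IsColouring H (suc k) β → IsColouring (SubstAll H) (4 + k) α
  α-proper _ (inj₁ a) (inj₁ b) adj e = CoreAdj⇒≢ adj (coreColour-injective e)
  α-proper _ (inj₁ v) (inj₂ (u , h)) v≢u e = copyColour≢coreColour (β h) v≢u (sym e)
  α-proper _ (inj₂ (u , h)) (inj₁ v) v≢u e = copyColour≢coreColour (β h) v≢u e
  α-proper β-proper (inj₂ (u , h)) (inj₂ (.u , h′)) (refl , adj) e =
    β-proper h h′ adj (copyColour-injective u e)

  module _ (p : V H) (β-frozen : IsFrozen H (suc k) β) where

    surjective : ∀ c → ∃ λ h → β h ≡ c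
    surjective = frozen⇒surjective β-frozen p

    seenFromCopy : ∀ t v → v ≢ t → ∀ c → Sees (SubstAll H) α (inj₁ v) (copyColour t c)
    seenFromCopy t v v≢t c with surjective c
    ... | h , βh≡c = inj₂ (inj₂ (t , h) , v≢t , cong (copyColour t) βh≡c)

    seenInCopy : ∀ u h c → Sees (SubstAll H) α (inj₂ (u , h)) (copyColour u c)
    seenInCopy u h c with β-frozen h c
    ... | inj₁ βh≡c             = inj₁ (cong (copyColour u) βh≡c)
    ... | inj₂ (h′ , adj , βh′≡c) =
      inj₂ (inj₂ (u , h′) , (refl , adj) , cong (copyColour u) βh′≡c)

    α-frozen : IsFrozen (SubstAll H) (4 + k) α
    α-frozen (inj₁ v) c with palette c
    ... | extra j = seenFromCopy (another v) v (another-≢ v) (suc j)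
    ... | core t with t ≟ v
    ...   | yes refl = inj₁ refl
    ...   | no t≢v   = seenFromCopy t v (t≢v ∘ sym) zero
    α-frozen (inj₂ (u , h)) c with palette c
    ... | extra j = seenInCopy u h (suc j)
    ... | core t with t ≟ u
    ...   | yes refl = seenInCopy u h zero
    ...   | no t≢u   = inj₂ (inj₁ t , t≢u , refl)

substAll-hasFrozenColouring : ∀ {H k} → V H → HasFrozenColouring H (suc k) →
                              HasFrozenColouring (SubstAll H) (3 + suc k)
substAll-hasFrozenColouring p (β , β-proper , β-frozen) =
  α , α-proper β-proper , α-frozen p β-frozen
  where open SubstAllColouring β

K₁ : Graph
K₁ = record { V = ⊤ ; Adj = λ _ _ → ⊥ }

K₁-hasFrozenColouring : HasFrozenColouring K₁ 1
K₁-hasFrozenColouring = (λ _ → zero) , (λ _ _ ()) , λ { _ zero → inj₁ refl }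

G1→SubstAllK₁ : LocallySurjectiveHom G1 (SubstAll K₁)
G1→SubstAllK₁ = record
  { vmap = vmap ; preserves = λ {a} {b} → preserves a b ; lift = λ {a} {b} → lift a b }
  where
  vmap : G1V → V (SubstAll K₁)
  vmap (inj₁ v) = inj₁ v
  vmap (inj₂ u) = inj₂ (u , tt)

  preserves : ∀ a b → G1Adj a b → Adj (SubstAll K₁) (vmap a) (vmap b)
  preserves (inj₁ _) (inj₁ _) adj = adj
  preserves (inj₁ _) (inj₂ _) adj = adj
  preserves (inj₂ _) (inj₁ _) adj = adj

  lift : ∀ a b → Adj (SubstAll K₁) (vmap a) b → ∃ λ b′ → G1Adj a b′ × vmap b′ ≡ b
  lift (inj₁ _) (inj₁ v)        adj = inj₁ v , adj , refl
  lift (inj₁ _) (inj₂ (u , tt)) adj = inj₂ u , adj , refl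
  lift (inj₂ _) (inj₁ v)        adj = inj₁ v , adj , refl

G-vertex : ∀ n → V (G (suc n))
G-vertex 0       = inj₁ w
G-vertex (suc n) = inj₁ w

G-hasFrozenColouring : ∀ n → HasFrozenColouring (G (suc n)) (3 * suc n + 1)
G-hasFrozenColouring 0 =
  hasFrozenColouring-pullback G1→SubstAllK₁
    (substAll-hasFrozenColouring tt K₁-hasFrozenColouring)
G-hasFrozenColouring (suc n) =
  subst (HasFrozenColouring (G (suc (suc n)))) (sym colours)
    (substAll-hasFrozenColouring (G-vertex n) (G-hasFrozenColouring n))
  where
  colours : 3 * suc (suc n) + 1 ≡ 3 + (3 * suc n + 1)
  colours = trans (cong (_+ 1) (*-suc 3 (suc n))) (+-assoc 3 (3 * suc n) 1)

lemma6 : (n : ℕ) → 1 ≤ n → HasFrozenColouring (G n) (3 * n + 1)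
lemma6 (suc n) (s≤s _) = G-hasFrozenColouring n
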